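{- Let $A$ be any cooperative collect algorithm for which the collective latency $\mathrm{CL}(A)$ and the private latency $\mathrm{PL}(A)$ are bounded. Then, in any execution of $A$ in which process $p$ completes a collect at time $t$, the total number of collects completed by $p$ by time $t$ is at least $F_p(t)-1$, where $$F_p(t)=\frac12\left(\frac{M_p(t)}{\mathrm{CL}(A)+2(n-1)}+\frac{N_p(t)}{\mathrm{PL}(A)}\right).$$
   Context: Model: $n$ processes communicate through atomic single-writer multi-reader registers, one register owned by each process; an execution is an interleaved sequence of steps (each a read or write of one register), whose order is determined by an adversarial schedule (a sequence of process identifiers). Time is measured by the total number of steps taken by all processes. A collect operation by a process obtains a value for each of the $n$ registers; each process repeatedly performs collects, starting a new one as soon as the previous finishes (in the algorithm, a collect is a sequence of atomic reads and writes). The collective latency $\mathrm{CL}(A)$ of a collect algorithm $A$ is a bound such that, in every execution and at every time $t$, the total number of read and write operations performed at time $t$ or later by the collects in progress at time $t$ is at most $\mathrm{CL}(A)$. The private latency $\mathrm{PL}(A)$ is the maximum number of read and write operations carried out by a single process during any one of its own collects. A step $\pi$ by a process $q$ is useful for $p$ if $\pi$ is part of a collect that started before $p$'s current collect. A step $\pi$ by a process $q$ is extraneous for $p$ if $\pi$ occurs during an interval where $p$ has finished one collect but has not yet taken any step of a new collect, and $\pi$ is either the first or the last operation of $q$ in this interval. $M_p(t)$ is the total number of steps that are useful or extraneous for $p$ among the first $t$ steps of the execution, and $N_p(t)$ is the number of steps carried out by $p$ among the first $t$ steps. -}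

module Defs where

open import Data.Nat using (ℕ; zero; suc; _+_; _*_; _∸_; _≤_; _<ᵇ_; _≡ᵇ_)
open import Data.Bool using (Bool; true; false; if_then_else_; _∧_; _∨_; not)
open import Data.Fin using (Fin)
open import Data.Fin.Properties using (_≟_)
open import Data.Product using (_×_; proj₁; proj₂; Σ)
open import Relation.Nullary.Decidable using (⌊_⌋)
open import Relation.Binary.PropositionalEquality using (_≡_)

-- A step of an execution: the process taking it, and a flag telling whether
-- this step is the last operation of that process's current collect
-- (i.e. the step completes a collect).  Whether the step is a read or a
-- write, and of which register, is irrelevant to the latency notions.
Step : ℕ → Set
Step n = Fin n × Bool

-- A (finite) execution: its length and its steps; step s (0-based) for s < len.
-- "Time t" = after the first t steps (steps 0 … t-1).
record Execution (n : ℕ) : Set where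
  field
    len  : ℕ
    step : ℕ → Step n
open Execution public

-- A collect algorithm, abstracted as the set of its executions.
Algorithm : ℕ → Set₁
Algorithm n = Execution n → Set

module _ {n : ℕ} (E : Execution n) where

  proc : ℕ → Fin n
  proc s = proj₁ (step E s)

  ends : ℕ → Bool
  ends s = proj₂ (step E s)

  isBy : Fin n → ℕ → Bool
  isBy q s = ⌊ q ≟ proc s ⌋

  isComp : Fin n → ℕ → Bool
  isComp q s = isBy q s ∧ ends s

  cnt : (ℕ → Bool) → ℕ → ℕ → ℕ
  cnt f a zero    = 0
  cnt f a (suc k) = (if f a then 1 else 0) + cnt f (suc a) k

  cntIn : (ℕ → Bool) → ℕ → ℕ → ℕ
  cntIn f a b = cnt f a (b ∸ a)

  -- number of collects completed by q within the first t steps;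
  -- this is also the index (0-based) of q's collect in progress at time t
  -- (a new collect starts as soon as the previous one finishes)
  done : Fin n → ℕ → ℕ
  done q t = cnt (isComp q) 0 t

  startCur : Fin n → ℕ → ℕ
  startCur q zero    = 0
  startCur q (suc s) = if isComp q s then suc s else startCur q s

  findFrom : (ℕ → Bool) → ℕ → ℕ → ℕ
  findFrom f a zero    = a
  findFrom f a (suc k) = if f a then a else findFrom f (suc a) k

  -- index of the next step of p at or after s (or len E if there is none)
  nextStep : Fin n → ℕ → ℕ
  nextStep p s = findFrom (isBy p) s (len E ∸ s)

  noStepIn : Fin n → ℕ → ℕ → Bool
  noStepIn q a b = cntIn (isBy q) a b ≡ᵇ 0

  -- step s is useful for p: it is part of a collect (of proc s) that started
  -- strictly before p's current collect (the one in progress when s occurs)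
  useful : Fin n → ℕ → Bool
  useful p s = startCur (proc s) s <ᵇ startCur p s

  -- step s is extraneous for p: s lies in an interval where p has finished a
  -- collect (at step startCur p s - 1) but has not yet taken a step of its new
  -- collect (interval = [startCur p s, nextStep p s)), and s is the first or the
  -- last operation of proc s in this interval
  extraneous : Fin n → ℕ → Bool
  extraneous p s =
    not (isBy p s)
    ∧ (0 <ᵇ done p s)
    ∧ noStepIn p (startCur p s) s
    ∧ (noStepIn (proc s) (startCur p s) s
       ∨ noStepIn (proc s) (suc s) (nextStep p s))

  M : Fin n → ℕ → ℕ
  M p t = cnt (λ s → useful p s ∨ extraneous p s) 0 t

  N : Fin n → ℕ → ℕ
  N p t = cnt (isBy p) 0 t

  -- step s (at time ≥ t) belongs to a collect that is in progress at time t
  partOfCollectInProgressAt : ℕ → ℕ → Bool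
  partOfCollectInProgressAt t s = done (proc s) s ≡ᵇ done (proc s) t

  CompletesAt : Fin n → ℕ → Set
  CompletesAt p t = Σ ℕ (λ s → (t ≡ suc s) × (t ≤ len E) × (isComp p s ≡ true))

CollectiveLatencyBound : {n : ℕ} → Algorithm n → ℕ → Set
CollectiveLatencyBound A cl =
  ∀ E → A E → ∀ t → t ≤ len E →
    cntIn E (partOfCollectInProgressAt E t) t (len E) ≤ cl

PrivateLatencyBound : {n : ℕ} → Algorithm n → ℕ → Set
PrivateLatencyBound A pl =
  ∀ E → A E → ∀ q k →
    cnt E (λ s → isBy E q s ∧ (done E q s ≡ᵇ k)) 0 (len E) ≤ pl

-- Charge every step that is useful or extraneous for p to the collect of p in
-- progress when it occurs, identified by that collect's start time a. A useful
-- step charged to a belongs to a collect that is still in progress at time a, so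
-- there are at most CL of them; an extraneous one is the first or last step of
-- some other process in the gap between a and p's next step, so there are at most
-- 2 (n - 1) of them. As p has started at most done + 1 collects, this gives
-- M ≤ (done + 1)(CL + 2 (n - 1)); likewise p's own steps lie in its done + 1
-- collects, N ≤ (done + 1) PL, and the two bounds add up to the claim.
module Submission where

open import Defs
open import Data.Nat using (ℕ; _+_; _*_; _∸_; _≤_)
open import Data.Fin using (Fin)

open import Data.Bool using (Bool; true; false; if_then_else_; _∧_; _∨_; not; T)
open import Data.Bool.Properties using (T-∧; T-∨)
open import Data.Fin using (toℕ)
open import Data.Fin.Properties using (toℕ<n; toℕ-injective)
open import Data.Nat using (zero; suc; _<_; _≤ᵇ_; _<ᵇ_; _≡ᵇ_; z≤n; s≤s; s≤s⁻¹; z<s)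
open import Data.Nat.Properties
open import Algebra.Properties.CommutativeSemigroup +-commutativeSemigroup using (interchange)
open import Data.Nat.Solver using (module +-*-Solver)
open import Data.Empty using (⊥)
open import Data.Product using (_×_; _,_; proj₁; proj₂)
open import Data.Sum using (_⊎_; inj₁; inj₂)
open import Function.Bundles using (Equivalence)
open import Relation.Nullary using (¬_; contradiction)
open import Relation.Nullary.Decidable using (fromWitness)
open import Relation.Binary.PropositionalEquality

𝟙 : Bool → ℕ
𝟙 b = if b then 1 else 0

𝟙≤1 : ∀ b → 𝟙 b ≤ 1
𝟙≤1 false = z≤n
𝟙≤1 true  = ≤-refl

𝟙-mono : ∀ {x y} → (T x → T y) → 𝟙 x ≤ 𝟙 y
𝟙-mono {false}         _ = z≤n
𝟙-mono {true}  {true}  _ = ≤-refl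
𝟙-mono {true}  {false} h = contradiction _ h

𝟙-∨ : ∀ x y → 𝟙 (x ∨ y) ≤ 𝟙 x + 𝟙 y
𝟙-∨ false y = ≤-refl
𝟙-∨ true  y = s≤s z≤n

¬T⇒𝟙≡0 : ∀ {b} → ¬ T b → 𝟙 b ≡ 0
¬T⇒𝟙≡0 {false} _ = refl
¬T⇒𝟙≡0 {true}  h = contradiction _ h

𝟙≡0⇒¬T : ∀ {b} → 𝟙 b ≡ 0 → ¬ T b
𝟙≡0⇒¬T {true} ()

T-not⁻ : ∀ {b} → T (not b) → ¬ T b
T-not⁻ {false} _ ()

T-not⁺ : ∀ {b} → ¬ T b → T (not b)
T-not⁺ {false} _ = _
T-not⁺ {true}  h = h _

∧⁻ : ∀ {x y} → T (x ∧ y) → T x × T y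
∧⁻ = Equivalence.to T-∧

∧⁺ : ∀ {x y} → T x → T y → T (x ∧ y)
∧⁺ tx ty = Equivalence.from T-∧ (tx , ty)

T-∧₄ : ∀ {w x y z} → T (w ∧ x ∧ y ∧ z) → T w × T x × T y × T z
T-∧₄ {true} {true} {true} {true} _ = _ , _ , _ , _
T-∧₄ {false}                     ()
T-∧₄ {true} {false}              ()
T-∧₄ {true} {true} {false}       ()
T-∧₄ {true} {true} {true} {false} ()

module _ {n : ℕ} (E : Execution n) where

  private
    <-suc-shift : ∀ {a k s} → s < suc a + k → s < a + suc k
    <-suc-shift {a} {k} {s} = subst (s <_) (sym (+-suc a k))

  cnt-+ : ∀ f a k m → cnt E f a (k + m) ≡ cnt E f a k + cnt E f (a + k) m
  cnt-+ f a zero    m rewrite +-identityʳ a = refl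
  cnt-+ f a (suc k) m rewrite cnt-+ f (suc a) k m | +-suc a k = sym (+-assoc (𝟙 (f a)) _ _)

  cnt-snoc : ∀ f k → cnt E f 0 (suc k) ≡ cnt E f 0 k + 𝟙 (f k)
  cnt-snoc f k = begin
    cnt E f 0 (suc k)            ≡⟨ cong (cnt E f 0) (+-comm 1 k) ⟩
    cnt E f 0 (k + 1)            ≡⟨ cnt-+ f 0 k 1 ⟩
    cnt E f 0 k + (𝟙 (f k) + 0)  ≡⟨ cong (cnt E f 0 k +_) (+-identityʳ _) ⟩
    cnt E f 0 k + 𝟙 (f k)        ∎
    where open ≡-Reasoning

  cnt-suc-shift : ∀ f a k → cnt E f (suc a) k ≡ cnt E (λ s → f (suc s)) a k
  cnt-suc-shift f a zero    = refl
  cnt-suc-shift f a (suc k) = cong (𝟙 (f (suc a)) +_) (cnt-suc-shift f (suc a) k)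

  cnt-≤-length : ∀ f a k → cnt E f a k ≤ k
  cnt-≤-length f a zero    = z≤n
  cnt-≤-length f a (suc k) = +-mono-≤ (𝟙≤1 (f a)) (cnt-≤-length f (suc a) k)

  cnt-length-mono : ∀ f a {k m} → k ≤ m → cnt E f a k ≤ cnt E f a m
  cnt-length-mono f a {zero}          _   = z≤n
  cnt-length-mono f a {suc k} {suc m} k≤m = +-monoʳ-≤ (𝟙 (f a)) (cnt-length-mono f (suc a) (s≤s⁻¹ k≤m))

  cnt-mono : ∀ {f g} a k → (∀ s → a ≤ s → s < a + k → T (f s) → T (g s)) → cnt E f a k ≤ cnt E g a k
  cnt-mono a zero    _ = z≤n
  cnt-mono a (suc k) h =
    +-mono-≤ (𝟙-mono (h a ≤-refl (m<m+n a z<s)))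
             (cnt-mono (suc a) k (λ s a<s s< → h s (<⇒≤ a<s) (<-suc-shift s<)))

  cnt-∨ : ∀ f g a k → cnt E (λ s → f s ∨ g s) a k ≤ cnt E f a k + cnt E g a k
  cnt-∨ f g a zero    = z≤n
  cnt-∨ f g a (suc k) = begin
    𝟙 (f a ∨ g a) + cnt E (λ s → f s ∨ g s) (suc a) k
      ≤⟨ +-mono-≤ (𝟙-∨ (f a) (g a)) (cnt-∨ f g (suc a) k) ⟩
    (𝟙 (f a) + 𝟙 (g a)) + (cnt E f (suc a) k + cnt E g (suc a) k)
      ≡⟨ interchange (𝟙 (f a)) _ _ _ ⟩
    (𝟙 (f a) + cnt E f (suc a) k) + (𝟙 (g a) + cnt E g (suc a) k) ∎
    where open ≤-Reasoning

  cnt-none : ∀ f a k → (∀ s → a ≤ s → s < a + k → ¬ T (f s)) → cnt E f a k ≡ 0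
  cnt-none f a zero    _ = refl
  cnt-none f a (suc k) h =
    cong₂ _+_ (¬T⇒𝟙≡0 (h a ≤-refl (m<m+n a z<s)))
              (cnt-none f (suc a) k (λ s a<s s< → h s (<⇒≤ a<s) (<-suc-shift s<)))

  cnt≡0⇒¬T : ∀ f a k → cnt E f a k ≡ 0 → ∀ s → a ≤ s → s < a + k → ¬ T (f s)
  cnt≡0⇒¬T f a zero    _ s a≤s s<a+0 = contradiction (subst (s <_) (+-identityʳ a) s<a+0) (≤⇒≯ a≤s)
  cnt≡0⇒¬T f a (suc k) c≡0 s a≤s s< with m≤n⇒m<n∨m≡n a≤s
  ... | inj₂ refl = 𝟙≡0⇒¬T (m+n≡0⇒m≡0 (𝟙 (f a)) c≡0)
  ... | inj₁ a<s  = cnt≡0⇒¬T f (suc a) k (m+n≡0⇒n≡0 (𝟙 (f a)) c≡0) s a<s (subst (s <_) (+-suc a k) s<)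

  cnt-≤1 : ∀ f a k → (∀ x y → a ≤ x → x < y → y < a + k → T (f x) → T (f y) → ⊥) → cnt E f a k ≤ 1
  cnt-≤1 f a zero    _ = z≤n
  cnt-≤1 f a (suc k) h with f a in fa
  ... | true  = s≤s (≤-reflexive (cnt-none f (suc a) k λ y a<y y< fy →
                  h a y ≤-refl a<y (<-suc-shift y<) (subst T (sym fa) _) fy))
  ... | false = cnt-≤1 f (suc a) k λ x y a<x x<y y< →
                  h x y (<⇒≤ a<x) x<y (<-suc-shift y<)

  cnt-from : ∀ f {a t u} → a ≤ u → t ≤ u → cnt E (λ s → (a ≤ᵇ s) ∧ f s) 0 t ≤ cntIn E f a u
  cnt-from f {a} {t} {u} a≤u t≤u = begin
    cnt E g 0 t                            ≤⟨ cnt-length-mono g 0 t≤u ⟩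
    cnt E g 0 u                            ≡⟨ cong (cnt E g 0) (m+[n∸m]≡n a≤u) ⟨
    cnt E g 0 (a + (u ∸ a))                ≡⟨ cnt-+ g 0 a (u ∸ a) ⟩
    cnt E g 0 a + cnt E g a (u ∸ a)        ≡⟨ cong (_+ cnt E g a (u ∸ a)) (cnt-none g 0 a before) ⟩
    cnt E g a (u ∸ a)                      ≤⟨ cnt-mono a (u ∸ a) (λ s _ _ h → proj₂ (∧⁻ h)) ⟩
    cnt E f a (u ∸ a)                      ∎
    where
      open ≤-Reasoning
      g : ℕ → Bool
      g s = (a ≤ᵇ s) ∧ f s
      before : ∀ s → 0 ≤ s → s < a → ¬ T (g s)
      before s _ s<a h = <⇒≱ s<a (≤ᵇ⇒≤ a s (proj₁ (∧⁻ h)))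

  cnt-missing : ∀ f {m} K → m < K → ¬ T (f m) → cnt E f 0 K ≤ K ∸ 1
  cnt-missing f {m} (suc K) m<1+K ¬fm with m≤n⇒m<n∨m≡n (s≤s⁻¹ m<1+K)
  ... | inj₂ refl = begin
    cnt E f 0 (suc m)      ≡⟨ cnt-snoc f m ⟩
    cnt E f 0 m + 𝟙 (f m)  ≡⟨ cong (cnt E f 0 m +_) (¬T⇒𝟙≡0 ¬fm) ⟩
    cnt E f 0 m + 0        ≡⟨ +-identityʳ _ ⟩
    cnt E f 0 m            ≤⟨ cnt-≤-length f 0 m ⟩
    m                      ∎
    where open ≤-Reasoning
  ... | inj₁ m<K = begin
    cnt E f 0 (suc K)      ≡⟨ cnt-snoc f K ⟩
    cnt E f 0 K + 𝟙 (f K)  ≤⟨ +-mono-≤ (cnt-missing f K m<K ¬fm) (𝟙≤1 (f K)) ⟩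
    K ∸ 1 + 1              ≡⟨ m∸n+n≡m (≤-trans (s≤s z≤n) m<K) ⟩
    K                      ∎
    where open ≤-Reasoning

  cnt-fibres : ∀ f L (ℓ : ℕ → ℕ) {t K B} →
    (∀ s → s < t → T (f s) → ℓ s < K × T (L (ℓ s))) →
    (∀ k → k < K → cnt E (λ s → f s ∧ (ℓ s ≡ᵇ k)) 0 t ≤ B) →
    cnt E f 0 t ≤ cnt E L 0 K * B
  cnt-fibres f L ℓ {t} {K} {B} labelled fibre =
    ≤-trans (cnt-mono 0 t λ s _ s<t fs → ∧⁺ fs (<⇒<ᵇ (proj₁ (labelled s s<t fs))))
            (below K ≤-refl)
    where
      open ≤-Reasoning

      fibreᴸ : ∀ k → k < K → cnt E (λ s → f s ∧ (ℓ s ≡ᵇ k)) 0 t ≤ 𝟙 (L k) * B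
      fibreᴸ k k<K with L k in Lk
      ... | true  = subst (_ ≤_) (sym (*-identityˡ B)) (fibre k k<K)
      ... | false = ≤-reflexive (cnt-none _ 0 t λ s _ s<t h →
        let (fs , ℓs≡k) = ∧⁻ h
        in subst T (trans (cong L (≡ᵇ⇒≡ (ℓ s) k ℓs≡k)) Lk) (proj₂ (labelled s s<t fs)))

      below : ∀ j → j ≤ K → cnt E (λ s → f s ∧ (ℓ s <ᵇ j)) 0 t ≤ cnt E L 0 j * B
      below zero    _   = ≤-reflexive (cnt-none _ 0 t λ s _ _ h → proj₂ (∧⁻ h))
      below (suc j) j<K = begin
        cnt E (λ s → f s ∧ (ℓ s <ᵇ suc j)) 0 t
          ≤⟨ cnt-mono 0 t (λ s _ _ → split s) ⟩
        cnt E (λ s → (f s ∧ (ℓ s <ᵇ j)) ∨ (f s ∧ (ℓ s ≡ᵇ j))) 0 t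
          ≤⟨ cnt-∨ _ _ 0 t ⟩
        cnt E (λ s → f s ∧ (ℓ s <ᵇ j)) 0 t + cnt E (λ s → f s ∧ (ℓ s ≡ᵇ j)) 0 t
          ≤⟨ +-mono-≤ (below j (<⇒≤ j<K)) (fibreᴸ j j<K) ⟩
        cnt E L 0 j * B + 𝟙 (L j) * B
          ≡⟨ *-distribʳ-+ B (cnt E L 0 j) (𝟙 (L j)) ⟨
        (cnt E L 0 j + 𝟙 (L j)) * B
          ≡⟨ cong (_* B) (sym (cnt-snoc L j)) ⟩
        cnt E L 0 (suc j) * B ∎
        where
          split : ∀ s → T (f s ∧ (ℓ s <ᵇ suc j)) → T ((f s ∧ (ℓ s <ᵇ j)) ∨ (f s ∧ (ℓ s ≡ᵇ j)))
          split s h with ∧⁻ h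
          ... | fs , ℓs<1+j with m<1+n⇒m<n∨m≡n (<ᵇ⇒< (ℓ s) (suc j) ℓs<1+j)
          ...   | inj₁ ℓs<j = Equivalence.from T-∨ (inj₁ (∧⁺ fs (<⇒<ᵇ ℓs<j)))
          ...   | inj₂ ℓs≡j = Equivalence.from T-∨ (inj₂ (∧⁺ fs (≡⇒≡ᵇ (ℓ s) j ℓs≡j)))

  cnt-≤-n∸1 : ∀ f (p : Fin n) t →
    (∀ s → s < t → T (f s) → proc E s ≢ p) →
    (∀ x y → x < y → y < t → T (f x) → T (f y) → proc E x ≢ proc E y) →
    cnt E f 0 t ≤ n ∸ 1
  cnt-≤-n∸1 f p t others distinct = begin
    cnt E f 0 t                                   ≤⟨ cnt-fibres f notP label labelled fibre ⟩
    cnt E notP 0 n * 1                            ≡⟨ *-identityʳ _ ⟩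
    cnt E notP 0 n                                ≤⟨ cnt-missing notP n (toℕ<n p) (λ h → T-not⁻ h (≡⇒≡ᵇ (toℕ p) _ refl)) ⟩
    n ∸ 1                                         ∎
    where
      open ≤-Reasoning
      label : ℕ → ℕ
      label s = toℕ (proc E s)
      notP : ℕ → Bool
      notP k = not (k ≡ᵇ toℕ p)

      labelled : ∀ s → s < t → T (f s) → label s < n × T (notP (label s))
      labelled s s<t fs = toℕ<n (proc E s) ,
        T-not⁺ (λ h → others s s<t fs (toℕ-injective (≡ᵇ⇒≡ _ _ h)))

      fibre : ∀ k → k < n → cnt E (λ s → f s ∧ (label s ≡ᵇ k)) 0 t ≤ 1
      fibre k _ = cnt-≤1 _ 0 t λ x y _ x<y y<t hx hy →
        let (fx , x↦k) = ∧⁻ hx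
            (fy , y↦k) = ∧⁻ hy
        in distinct x y x<y y<t fx fy
             (toℕ-injective (trans (≡ᵇ⇒≡ _ k x↦k) (sym (≡ᵇ⇒≡ _ k y↦k))))

  isBy-proc : ∀ s → T (isBy E (proc E s) s)
  isBy-proc s = fromWitness refl

  noStepIn⇒¬isBy : ∀ q {a b s} → T (noStepIn E q a b) → a ≤ s → s < b → ¬ T (isBy E q s)
  noStepIn⇒¬isBy q {a} {b} {s} none a≤s s<b =
    cnt≡0⇒¬T (isBy E q) a (b ∸ a) (≡ᵇ⇒≡ _ 0 none) s a≤s
             (subst (s <_) (sym (m+[n∸m]≡n (≤-trans a≤s (<⇒≤ s<b)))) s<b)

  findFrom-≥ : ∀ f a k → a ≤ findFrom E f a k
  findFrom-≥ f a zero    = ≤-refl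
  findFrom-≥ f a (suc k) with f a
  ... | true  = ≤-refl
  ... | false = ≤-trans (n≤1+n a) (findFrom-≥ f (suc a) k)

  findFrom-> : ∀ f a k {b} → a ≤ b → b < a + k → (∀ x → a ≤ x → x ≤ b → ¬ T (f x)) → b < findFrom E f a k
  findFrom-> f a zero    a≤b b<a+0 _ = contradiction (subst (_ <_) (+-identityʳ a) b<a+0) (≤⇒≯ a≤b)
  findFrom-> f a (suc k) {b} a≤b b< h with f a in fa
  ... | true  = contradiction (subst T (sym fa) _) (h a ≤-refl a≤b)
  ... | false with m≤n⇒m<n∨m≡n a≤b
  ...   | inj₂ refl = findFrom-≥ f (suc a) k
  ...   | inj₁ a<b  = findFrom-> f (suc a) k a<b (subst (b <_) (+-suc a k) b<)
                        λ x a<x x≤b → h x (<⇒≤ a<x) x≤b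

  noStep-through : ∀ q {a c y} → T (noStepIn E q a y) → ¬ T (isBy E q y) → a ≤ c → c ≤ y → ¬ T (isBy E q c)
  noStep-through q idle ¬by a≤c c≤y with m≤n⇒m<n∨m≡n c≤y
  ... | inj₁ c<y  = noStepIn⇒¬isBy q idle a≤c c<y
  ... | inj₂ refl = ¬by

  <-nextStep : ∀ q {x y} → x ≤ y → y < len E → (∀ z → x ≤ z → z ≤ y → ¬ T (isBy E q z)) → y < nextStep E q x
  <-nextStep q {x} {y} x≤y y<len idle =
    findFrom-> (isBy E q) x (len E ∸ x) x≤y (subst (y <_) (sym (m+[n∸m]≡n x≤len)) y<len) idle
    where x≤len = ≤-trans x≤y (<⇒≤ y<len)

  startCur-≤ : ∀ q s → startCur E q s ≤ s
  startCur-≤ q zero    = z≤n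
  startCur-≤ q (suc s) with isComp E q s
  ... | true  = ≤-refl
  ... | false = ≤-trans (startCur-≤ q s) (n≤1+n s)

  done-mono : ∀ q {s t} → s ≤ t → done E q s ≤ done E q t
  done-mono q = cnt-length-mono (isComp E q) 0

  done-startCur : ∀ q s {b} → startCur E q s ≤ b → b ≤ s → done E q b ≡ done E q s
  done-startCur q zero    _      b≤0 = cong (done E q) (n≤0⇒n≡0 b≤0)
  done-startCur q (suc s) {b} sc≤b b≤s with isComp E q s in comp
  ... | true  = cong (done E q) (≤-antisym b≤s sc≤b)
  ... | false with m≤n⇒m<n∨m≡n b≤s
  ...   | inj₂ refl = refl
  ...   | inj₁ b<s  = begin
    done E q b                           ≡⟨ done-startCur q s sc≤b (s≤s⁻¹ b<s) ⟩
    done E q s                           ≡⟨ +-identityʳ _ ⟨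
    done E q s + 0                       ≡⟨ cong (λ c → done E q s + 𝟙 c) comp ⟨
    done E q s + 𝟙 (isComp E q s)        ≡⟨ cnt-snoc (isComp E q) s ⟨
    done E q (suc s)                     ∎
    where open ≡-Reasoning

  collectStart : Fin n → ℕ → Bool
  collectStart p zero    = true
  collectStart p (suc s) = isComp E p s

  collectStart-startCur : ∀ p s → T (collectStart p (startCur E p s))
  collectStart-startCur p zero    = _
  collectStart-startCur p (suc s) with isComp E p s in comp
  ... | true  = subst T (sym comp) _
  ... | false = collectStart-startCur p s

  cnt-collectStart : ∀ p t → cnt E (collectStart p) 0 t ≤ suc (done E p t)
  cnt-collectStart p zero    = z≤n
  cnt-collectStart p (suc t) =
    s≤s (≤-trans (≤-reflexive (cnt-suc-shift (collectStart p) 0 t)) (done-mono p (n≤1+n t)))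

  module _ (p : Fin n) where

    firstInGap lastInGap : ℕ → ℕ → Bool
    firstInGap a s = (a ≤ᵇ s) ∧ not (isBy E p s) ∧ noStepIn E p a s ∧ noStepIn E (proc E s) a s
    lastInGap  a s = (a ≤ᵇ s) ∧ not (isBy E p s) ∧ noStepIn E p a s
                       ∧ noStepIn E (proc E s) (suc s) (nextStep E p s)

    firstInGap⁻ : ∀ a s → T (firstInGap a s) →
      a ≤ s × ¬ T (isBy E p s) × T (noStepIn E p a s) × T (noStepIn E (proc E s) a s)
    firstInGap⁻ a s h =
      let (a≤s , ¬byP , idle , idleQ) =
            T-∧₄ {a ≤ᵇ s} {not (isBy E p s)} {noStepIn E p a s} {noStepIn E (proc E s) a s} h
      in ≤ᵇ⇒≤ a s a≤s , T-not⁻ ¬byP , idle , idleQ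

    lastInGap⁻ : ∀ a s → T (lastInGap a s) →
      a ≤ s × ¬ T (isBy E p s) × T (noStepIn E p a s) × T (noStepIn E (proc E s) (suc s) (nextStep E p s))
    lastInGap⁻ a s h =
      let (a≤s , ¬byP , idle , idleQ) =
            T-∧₄ {a ≤ᵇ s} {not (isBy E p s)} {noStepIn E p a s}
                 {noStepIn E (proc E s) (suc s) (nextStep E p s)} h
      in ≤ᵇ⇒≤ a s a≤s , T-not⁻ ¬byP , idle , idleQ

    cnt-firstInGap : ∀ a t → cnt E (firstInGap a) 0 t ≤ n ∸ 1
    cnt-firstInGap a t = cnt-≤-n∸1 (firstInGap a) p t others distinct
      where
        others : ∀ s → s < t → T (firstInGap a s) → proc E s ≢ p
        others s _ h refl = let (_ , ¬byP , _) = firstInGap⁻ a s h in ¬byP (isBy-proc s)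

        distinct : ∀ x y → x < y → y < t → T (firstInGap a x) → T (firstInGap a y) → proc E x ≢ proc E y
        distinct x y x<y _ hx hy px≡py =
          let (a≤x , _) = firstInGap⁻ a x hx
              (_ , _ , _ , idleQ) = firstInGap⁻ a y hy
          in noStepIn⇒¬isBy (proc E y) idleQ a≤x x<y (subst (λ q → T (isBy E q x)) px≡py (isBy-proc x))

    cnt-lastInGap : ∀ a t → t ≤ len E → cnt E (lastInGap a) 0 t ≤ n ∸ 1
    cnt-lastInGap a t t≤len = cnt-≤-n∸1 (lastInGap a) p t others distinct
      where
        others : ∀ s → s < t → T (lastInGap a s) → proc E s ≢ p
        others s _ h refl = let (_ , ¬byP , _) = lastInGap⁻ a s h in ¬byP (isBy-proc s)

        distinct : ∀ x y → x < y → y < t → T (lastInGap a x) → T (lastInGap a y) → proc E x ≢ proc E y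
        distinct x y x<y y<t hx hy px≡py =
          let (a≤x , _ , _ , idleQ) = lastInGap⁻ a x hx
              (_ , ¬byP , idleP , _) = lastInGap⁻ a y hy
              y<next = <-nextStep p (<⇒≤ x<y) (<-≤-trans y<t t≤len)
                         (λ z x≤z → noStep-through p idleP ¬byP (≤-trans a≤x x≤z))
          in noStepIn⇒¬isBy (proc E x) idleQ x<y y<next
               (subst (λ q → T (isBy E q y)) (sym px≡py) (isBy-proc y))

    useful⇒inProgress : ∀ s → T (useful E p s) →
      T ((startCur E p s ≤ᵇ s) ∧ partOfCollectInProgressAt E (startCur E p s) s)
    useful⇒inProgress s h = ∧⁺ (≤⇒≤ᵇ (startCur-≤ p s)) (≡⇒≡ᵇ _ _ (sym sameCollect))
      where
        sameCollect : done E (proc E s) (startCur E p s) ≡ done E (proc E s) s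
        sameCollect = done-startCur (proc E s) s (<⇒≤ (<ᵇ⇒< _ _ h)) (startCur-≤ p s)

    extraneous⇒inGap : ∀ s → T (extraneous E p s) →
      T (firstInGap (startCur E p s) s ∨ lastInGap (startCur E p s) s)
    extraneous⇒inGap s h =
      let (¬byP , _ , idle , firstOrLast) =
            T-∧₄ {not (isBy E p s)} {0 <ᵇ done E p s} {noStepIn E p (startCur E p s) s} h
          inGap : ∀ {c} → T c → T ((startCur E p s ≤ᵇ s) ∧ not (isBy E p s) ∧ noStepIn E p (startCur E p s) s ∧ c)
          inGap c = ∧⁺ (≤⇒≤ᵇ (startCur-≤ p s)) (∧⁺ ¬byP (∧⁺ idle c))
      in Equivalence.from T-∨ (Data.Sum.map inGap inGap (Equivalence.to T-∨ firstOrLast))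

    cnt-chargedTo-≤ : ∀ cl a t → a < t → t ≤ len E →
      cntIn E (partOfCollectInProgressAt E a) a (len E) ≤ cl →
      cnt E (λ s → (useful E p s ∨ extraneous E p s) ∧ (startCur E p s ≡ᵇ a)) 0 t ≤ cl + 2 * (n ∸ 1)
    cnt-chargedTo-≤ cl a t a<t t≤len clBound = begin
      cnt E (λ s → (useful E p s ∨ extraneous E p s) ∧ (startCur E p s ≡ᵇ a)) 0 t
        ≤⟨ cnt-mono 0 t (λ s _ _ → charge s) ⟩
      cnt E (λ s → inProgress s ∨ (firstInGap a s ∨ lastInGap a s)) 0 t
        ≤⟨ cnt-∨ inProgress _ 0 t ⟩
      cnt E inProgress 0 t + cnt E (λ s → firstInGap a s ∨ lastInGap a s) 0 t
        ≤⟨ +-monoʳ-≤ (cnt E inProgress 0 t) (cnt-∨ (firstInGap a) (lastInGap a) 0 t) ⟩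
      cnt E inProgress 0 t + (cnt E (firstInGap a) 0 t + cnt E (lastInGap a) 0 t)
        ≤⟨ +-mono-≤ (≤-trans (cnt-from (partOfCollectInProgressAt E a) a≤len t≤len) clBound)
                    (+-mono-≤ (cnt-firstInGap a t) (cnt-lastInGap a t t≤len)) ⟩
      cl + ((n ∸ 1) + (n ∸ 1))
        ≡⟨ cong (λ m → cl + ((n ∸ 1) + m)) (+-identityʳ (n ∸ 1)) ⟨
      cl + 2 * (n ∸ 1) ∎
      where
        open ≤-Reasoning
        a≤len = ≤-trans (<⇒≤ a<t) t≤len

        inProgress : ℕ → Bool
        inProgress s = (a ≤ᵇ s) ∧ partOfCollectInProgressAt E a s

        charge : ∀ s → T ((useful E p s ∨ extraneous E p s) ∧ (startCur E p s ≡ᵇ a)) →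
                 T (inProgress s ∨ (firstInGap a s ∨ lastInGap a s))
        charge s h with ∧⁻ {useful E p s ∨ extraneous E p s} h
        ... | chargeable , startsAt-a
              with ≡ᵇ⇒≡ (startCur E p s) a startsAt-a
                 | Equivalence.to (T-∨ {useful E p s} {extraneous E p s}) chargeable
        ...   | refl | inj₁ u = Equivalence.from (T-∨ {inProgress s}) (inj₁ (useful⇒inProgress s u))
        ...   | refl | inj₂ x = Equivalence.from (T-∨ {inProgress s}) (inj₂ (extraneous⇒inGap s x))

    M-bound : ∀ cl t → t ≤ len E →
      (∀ a → a ≤ len E → cntIn E (partOfCollectInProgressAt E a) a (len E) ≤ cl) →
      M E p t ≤ suc (done E p t) * (cl + 2 * (n ∸ 1))
    M-bound cl t t≤len clBound = begin
      M E p t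
        ≤⟨ cnt-fibres _ (collectStart p) (startCur E p) labelled fibre ⟩
      cnt E (collectStart p) 0 t * (cl + 2 * (n ∸ 1))
        ≤⟨ *-monoˡ-≤ _ (cnt-collectStart p t) ⟩
      suc (done E p t) * (cl + 2 * (n ∸ 1)) ∎
      where
        open ≤-Reasoning
        labelled : ∀ s → s < t → T (useful E p s ∨ extraneous E p s) →
                   startCur E p s < t × T (collectStart p (startCur E p s))
        labelled s s<t _ = ≤-<-trans (startCur-≤ p s) s<t , collectStart-startCur p s

        fibre : ∀ a → a < t →
          cnt E (λ s → (useful E p s ∨ extraneous E p s) ∧ (startCur E p s ≡ᵇ a)) 0 t ≤ cl + 2 * (n ∸ 1)
        fibre a a<t = cnt-chargedTo-≤ cl a t a<t t≤len (clBound a (≤-trans (<⇒≤ a<t) t≤len))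

    N-bound : ∀ pl t → t ≤ len E →
      (∀ k → cnt E (λ s → isBy E p s ∧ (done E p s ≡ᵇ k)) 0 (len E) ≤ pl) →
      N E p t ≤ suc (done E p t) * pl
    N-bound pl t t≤len plBound = begin
      N E p t                           ≤⟨ cnt-fibres (isBy E p) (λ _ → true) (done E p) labelled fibre ⟩
      cnt E (λ _ → true) 0 D * pl       ≤⟨ *-monoˡ-≤ pl (cnt-≤-length (λ _ → true) 0 D) ⟩
      D * pl                            ∎
      where
        open ≤-Reasoning
        D = suc (done E p t)

        labelled : ∀ s → s < t → T (isBy E p s) → done E p s < D × T true
        labelled s s<t _ = s≤s (done-mono p (<⇒≤ s<t)) , _

        fibre : ∀ k → k < D → cnt E (λ s → isBy E p s ∧ (done E p s ≡ᵇ k)) 0 t ≤ pl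
        fibre k _ = ≤-trans (cnt-length-mono (λ s → isBy E p s ∧ (done E p s ≡ᵇ k)) 0 t≤len) (plBound k)

lemma1 : {n : ℕ} (A : Algorithm n) (cl pl : ℕ)
    → CollectiveLatencyBound A cl → PrivateLatencyBound A pl
    → (E : Execution n) → A E → (p : Fin n) (t : ℕ) → CompletesAt E p t
    → M E p t * pl + N E p t * (cl + 2 * (n ∸ 1))
      ≤ 2 * (cl + 2 * (n ∸ 1)) * pl * (done E p t + 1)
lemma1 {n} A cl pl clBound plBound E inA p t (_ , _ , t≤len , _) = begin
  M E p t * pl + N E p t * C
    ≤⟨ +-mono-≤ (*-monoˡ-≤ pl (M-bound E p cl t t≤len (clBound E inA)))
                (*-monoˡ-≤ C (N-bound E p pl t t≤len (plBound E inA p))) ⟩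
  suc D * C * pl + suc D * pl * C
    ≡⟨ solve 3 (λ c q d → (con 1 :+ d) :* c :* q :+ (con 1 :+ d) :* q :* c
                          := con 2 :* c :* q :* (d :+ con 1)) refl C pl D ⟩
  2 * C * pl * (D + 1) ∎
  where
    open ≤-Reasoning
    open +-*-Solver
    C = cl + 2 * (n ∸ 1)
    D = done E p t
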